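{- For any graph $G$ without isolated vertices, $\mathrm{bcw}_1(G)\le (\Delta(G)+1)\,\mathcal H(G)$.
   Context: All graphs are finite, simple and undirected; $\Delta(G)$ is the maximum degree. Hunters and Rabbit game on $G$: the rabbit occupies an initially unknown vertex. In each round the hunters shoot a set of at most $k$ vertices; if the rabbit is on one of them it is caught, otherwise the rabbit must move to an adjacent vertex. The hunters cannot see the rabbit. The hunting number $\mathcal H(G)$ is the minimum $k$ such that some finite sequence of shot sets of size at most $k$ catches the rabbit regardless of its initial position and moves. For radius-$1$ blind cop-width: a blind strategy is a sequence $C_1,\dots,C_m\subseteq V(G)$ using $\max_i|C_i|$ cops, with $A_1=V(G)\setminus C_1$ and $A_{i+1}$ the set of $u\in V(G)\setminus C_{i+1}$ reachable from some vertex of $A_i$ by a path of length at most $1$ (length $0$ allowed) in $G\setminus(C_i\cap C_{i+1})$; it is winning if $A_m=\emptyset$. $\mathrm{bcw}_1(G)$ is the minimum number of cops of a winning strategy. -}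

module Defs where

open import Data.Nat using (ℕ; _≤_; _⊔_; _<_)
open import Data.Bool using (Bool; true; false)
open import Data.Fin using (Fin)
open import Data.Fin.Subset using (Subset; _∈_; _∉_; _∩_; ∣_∣)
open import Data.Vec using (tabulate)
open import Data.List using (List; []; _∷_; foldr; map; allFin)
open import Data.List.Relation.Unary.All using (All)
open import Data.Product using (Σ; ∃; _×_)
open import Data.Sum using (_⊎_)
open import Data.Unit using (⊤)
open import Relation.Binary.PropositionalEquality using (_≡_)
open import Relation.Nullary using (¬_)

record Graph : Set where
  field
    n      : ℕ
    adj    : Fin n → Fin n → Bool
    sym    : ∀ u v → adj u v ≡ adj v u
    irrefl : ∀ v → adj v v ≡ false

open Graph public

Adj : (G : Graph) → Fin (n G) → Fin (n G) → Set
Adj G u v = adj G u v ≡ true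

N : (G : Graph) → Fin (n G) → Subset (n G)
N G v = tabulate (adj G v)

degree : (G : Graph) → Fin (n G) → ℕ
degree G v = ∣ N G v ∣

maxDegree : Graph → ℕ
maxDegree G = foldr _⊔_ 0 (map (degree G) (allFin (n G)))

NoIsolatedVertices : Graph → Set
NoIsolatedVertices G = ∀ v → ∃ λ u → Adj G v u

-- Escapes G shots v : the rabbit, starting at v in the round of the first
-- shot, has a sequence of moves (each to an adjacent vertex) avoiding
-- every shot of the sequence.
Escapes : (G : Graph) → List (Subset (n G)) → Fin (n G) → Set
Escapes G [] v = ⊤
Escapes G (S ∷ []) v = v ∉ S
Escapes G (S ∷ S' ∷ Ss) v = v ∉ S × Σ (Fin (n G)) λ u → Adj G v u × Escapes G (S' ∷ Ss) u

HuntersWin : (G : Graph) → ℕ → Set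
HuntersWin G k = Σ (List (Subset (n G))) λ shots →
  All (λ S → ∣ S ∣ ≤ k) shots × (∀ v → ¬ Escapes G shots v)

IsHuntingNumber : Graph → ℕ → Set
IsHuntingNumber G h = HuntersWin G h × (∀ k → k < h → ¬ HuntersWin G k)

PathLe1Avoiding : (G : Graph) → Subset (n G) → Fin (n G) → Fin (n G) → Set
PathLe1Avoiding G X a u = (a ≡ u × a ∉ X) ⊎ (Adj G a u × a ∉ X × u ∉ X)

-- A_{i+1} from A_i, C_i, C_{i+1}
step : (G : Graph) → (Fin (n G) → Set) → Subset (n G) → Subset (n G) → Fin (n G) → Set
step G A C C' u = u ∉ C' × Σ (Fin (n G)) λ a → A a × PathLe1Avoiding G (C ∩ C') a u

-- final A C Cs : the set A_m, given current set A_i = A, current cop set C_i = C,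
-- and remaining cop sets Cs = C_{i+1}, …, C_m
final : (G : Graph) → (Fin (n G) → Set) → Subset (n G) → List (Subset (n G)) → Fin (n G) → Set
final G A C [] = A
final G A C (C' ∷ Cs) = final G (step G A C C') C' Cs

BlindWins : (G : Graph) → ℕ → Set
BlindWins G k = Σ (Subset (n G)) λ C₁ → Σ (List (Subset (n G))) λ Cs →
  ∣ C₁ ∣ ≤ k × All (λ C → ∣ C ∣ ≤ k) Cs ×
  (∀ u → ¬ final G (λ v → v ∉ C₁) C₁ Cs u)

IsBcw1 : Graph → ℕ → Set
IsBcw1 G b = BlindWins G b × (∀ k → k < b → ¬ BlindWins G k)

-- Let the hunters win with shots S₁, …, Sₘ and place the cops on the closed
-- neighbourhoods N[S₁], …, N[Sₘ], of size at most (Δ + 1) |Sᵢ|. Call a vertex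
-- trapped at round i if it avoids Sᵢ and a rabbit standing there cannot evade
-- Sᵢ, …, Sₘ. Every vertex of the contaminated set Aᵢ is trapped or adjacent to
-- a trapped vertex, and this survives each round; at the last round no vertex
-- is trapped, so Aₘ is empty.
module Submission where

open import Defs hiding (sym)
open import Data.Nat using (ℕ; _≤_; _*_; _+_; z≤n; s≤s; _⊔_)
open import Data.Nat.Properties
  using (≤-trans; ≤-reflexive; +-mono-≤; +-monoʳ-≤; *-monoʳ-≤; *-suc; +-suc; +-comm; n≤1+n; m≤m⊔n; m≤n⊔m; ≮⇒≥; module ≤-Reasoning)
open import Data.Fin using (Fin; zero; suc)
open import Data.Fin.Subset using (Subset; _∈_; _∉_; _∪_; ⊥; ⁅_⁆; ∣_∣)
open import Data.Fin.Subset.Properties using (∣⊥∣≡0; ∣⁅x⁆∣≡1; x∈⁅x⁆; x∈p∪q⁺)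
open import Data.Vec using ([]; _∷_; here; there)
open import Data.Vec.Properties using (lookup∘tabulate; lookup⇒[]=)
open import Data.Bool using (true; false)
open import Data.List using (List; []; _∷_; map; foldr)
open import Data.List.Membership.Propositional using () renaming (_∈_ to _∈ˡ_)
open import Data.List.Membership.Propositional.Properties using (∈-allFin)
open import Data.List.Relation.Unary.Any using () renaming (here to hereˡ; there to thereˡ)
open import Data.List.Relation.Unary.All using (All; []; _∷_)
import Data.List.Relation.Unary.All as All
import Data.List.Relation.Unary.All.Properties as All
open import Data.Product using (∃; _×_; _,_)
open import Data.Sum using (_⊎_; inj₁; inj₂)
open import Data.Unit using (tt)
open import Relation.Binary.PropositionalEquality using (refl; sym; trans; cong)
open import Relation.Nullary using (¬_)

∣p∪q∣≤∣p∣+∣q∣ : ∀ {m} (p q : Subset m) → ∣ p ∪ q ∣ ≤ ∣ p ∣ + ∣ q ∣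
∣p∪q∣≤∣p∣+∣q∣ []          []          = z≤n
∣p∪q∣≤∣p∣+∣q∣ (true ∷ p)  (true ∷ q)  =
  s≤s (≤-trans (∣p∪q∣≤∣p∣+∣q∣ p q) (+-monoʳ-≤ ∣ p ∣ (n≤1+n ∣ q ∣)))
∣p∪q∣≤∣p∣+∣q∣ (true ∷ p)  (false ∷ q) = s≤s (∣p∪q∣≤∣p∣+∣q∣ p q)
∣p∪q∣≤∣p∣+∣q∣ (false ∷ p) (true ∷ q)  =
  ≤-trans (s≤s (∣p∪q∣≤∣p∣+∣q∣ p q)) (≤-reflexive (sym (+-suc ∣ p ∣ ∣ q ∣)))
∣p∪q∣≤∣p∣+∣q∣ (false ∷ p) (false ∷ q) = ∣p∪q∣≤∣p∣+∣q∣ p q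

≤-foldr-⊔ : ∀ {A : Set} (f : A → ℕ) {x} {xs : List A} → x ∈ˡ xs → f x ≤ foldr _⊔_ 0 (map f xs)
≤-foldr-⊔ f (hereˡ refl) = m≤m⊔n _ _
≤-foldr-⊔ f (thereˡ x∈xs) = ≤-trans (≤-foldr-⊔ f x∈xs) (m≤n⊔m _ _)

⋃[_]_ : ∀ {m k} → Subset m → (Fin m → Subset k) → Subset k
⋃[ [] ]        f = ⊥
⋃[ true ∷ S ]  f = f zero ∪ ⋃[ S ] (λ x → f (suc x))
⋃[ false ∷ S ] f = ⋃[ S ] (λ x → f (suc x))

∈⋃⁺ : ∀ {m k} {S : Subset m} (f : Fin m → Subset k) {x y} → x ∈ S → y ∈ f x → y ∈ ⋃[ S ] f
∈⋃⁺ {S = true ∷ _} f here y∈fx = x∈p∪q⁺ (inj₁ y∈fx)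
∈⋃⁺ {S = true ∷ _} f (there x∈S) y∈fx = x∈p∪q⁺ (inj₂ (∈⋃⁺ (λ z → f (suc z)) x∈S y∈fx))
∈⋃⁺ {S = false ∷ _} f (there x∈S) y∈fx = ∈⋃⁺ (λ z → f (suc z)) x∈S y∈fx

∣⋃∣≤ : ∀ {m k} (c : ℕ) (S : Subset m) (f : Fin m → Subset k) →
  (∀ x → ∣ f x ∣ ≤ c) → ∣ ⋃[ S ] f ∣ ≤ c * ∣ S ∣
∣⋃∣≤ {k = k} c [] f ∣f∣≤c = ≤-trans (≤-reflexive (∣⊥∣≡0 k)) z≤n
∣⋃∣≤ c (true ∷ S) f ∣f∣≤c =
  ≤-trans (∣p∪q∣≤∣p∣+∣q∣ (f zero) _)
    (≤-trans (+-mono-≤ (∣f∣≤c zero) (∣⋃∣≤ c S (λ x → f (suc x)) (λ x → ∣f∣≤c (suc x))))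
      (≤-reflexive (sym (*-suc c ∣ S ∣))))
∣⋃∣≤ c (false ∷ S) f ∣f∣≤c = ∣⋃∣≤ c S (λ x → f (suc x)) (λ x → ∣f∣≤c (suc x))

module _ (G : Graph) where

  private
    V = Fin (n G)
    Δ = maxDegree G

  Adj-sym : ∀ {u v} → Adj G u v → Adj G v u
  Adj-sym {u} {v} uv = trans (Graph.sym G v u) uv

  Adj⇒∈N : ∀ {u v} → Adj G u v → v ∈ N G u
  Adj⇒∈N {u} {v} uv = lookup⇒[]= v (N G u) (trans (lookup∘tabulate (adj G u) v) uv)

  degree≤Δ : ∀ v → degree G v ≤ Δ
  degree≤Δ v = ≤-foldr-⊔ (degree G) (∈-allFin v)

  N[_] : V → Subset (n G)
  N[ v ] = ⁅ v ⁆ ∪ N G v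

  ∣N[v]∣≤Δ+1 : ∀ v → ∣ N[ v ] ∣ ≤ Δ + 1
  ∣N[v]∣≤Δ+1 v = begin
    ∣ ⁅ v ⁆ ∪ N G v ∣        ≤⟨ ∣p∪q∣≤∣p∣+∣q∣ ⁅ v ⁆ (N G v) ⟩
    ∣ ⁅ v ⁆ ∣ + degree G v   ≡⟨ cong (_+ degree G v) (∣⁅x⁆∣≡1 v) ⟩
    1 + degree G v           ≤⟨ s≤s (degree≤Δ v) ⟩
    1 + Δ                    ≡⟨ +-comm 1 Δ ⟩
    Δ + 1                    ∎
    where open ≤-Reasoning

  N⟦_⟧ : Subset (n G) → Subset (n G)
  N⟦ S ⟧ = ⋃[ S ] N[_]

  ∉N⟦⟧⇒∉ : ∀ {S u} → u ∉ N⟦ S ⟧ → u ∉ S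
  ∉N⟦⟧⇒∉ {u = u} u∉NS u∈S = u∉NS (∈⋃⁺ N[_] u∈S (x∈p∪q⁺ (inj₁ (x∈⁅x⁆ u))))

  ∉N⟦⟧⇒Adj⇒∉ : ∀ {S u w} → u ∉ N⟦ S ⟧ → Adj G u w → w ∉ S
  ∉N⟦⟧⇒Adj⇒∉ u∉NS uw w∈S = u∉NS (∈⋃⁺ N[_] w∈S (x∈p∪q⁺ (inj₂ (Adj⇒∈N (Adj-sym uw)))))

  Trapped : Subset (n G) → List (Subset (n G)) → V → Set
  Trapped S Ss r = r ∉ S × ¬ Escapes G (S ∷ Ss) r

  Trapped-last : ∀ {S r} → ¬ Trapped S [] r
  Trapped-last (r∉S , ¬esc) = ¬esc r∉S

  Trapped-step : ∀ {S S' Ss r u} → Trapped S (S' ∷ Ss) r → Adj G r u → u ∉ S' → Trapped S' Ss u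
  Trapped-step (r∉S , ¬esc) ru u∉S' = u∉S' , λ esc → ¬esc (r∉S , _ , ru , esc)

  Near : (V → Set) → V → Set
  Near P u = P u ⊎ ∃ λ r → Adj G u r × P r

  -- A
  -- rabbit that stayed on a trapped vertex is covered through a neighbour, which
  -- is where isolated vertices must be excluded.
  step-nearTrapped : NoIsolatedVertices G → ∀ {S S' Ss} {A : V → Set} →
    (∀ {a} → A a → Near (Trapped S (S' ∷ Ss)) a) →
    ∀ {u} → step G A N⟦ S ⟧ N⟦ S' ⟧ u → Near (Trapped S' Ss) u
  step-nearTrapped noIso near (u∉C' , a , Aa , inj₁ (refl , _)) with near Aa
  ... | inj₁ trapped =
    let (w , aw) = noIso a in inj₂ (w , aw , Trapped-step trapped aw (∉N⟦⟧⇒Adj⇒∉ u∉C' aw))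
  ... | inj₂ (r , ar , trapped) = inj₁ (Trapped-step trapped (Adj-sym ar) (∉N⟦⟧⇒∉ u∉C'))
  step-nearTrapped noIso near (u∉C' , a , Aa , inj₂ (au , _)) with near Aa
  ... | inj₁ trapped = inj₁ (Trapped-step trapped au (∉N⟦⟧⇒∉ u∉C'))
  ... | inj₂ (r , ar , trapped) =
    inj₂ (a , Adj-sym au , Trapped-step trapped (Adj-sym ar) (∉N⟦⟧⇒Adj⇒∉ u∉C' (Adj-sym au)))

  ¬final-nearTrapped : NoIsolatedVertices G → ∀ S Ss (A : V → Set) →
    (∀ {u} → A u → Near (Trapped S Ss) u) →
    ∀ u → ¬ final G A N⟦ S ⟧ (map N⟦_⟧ Ss) u
  ¬final-nearTrapped noIso S [] A near u Au with near Au
  ... | inj₁ trapped           = Trapped-last trapped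
  ... | inj₂ (_ , _ , trapped) = Trapped-last trapped
  ¬final-nearTrapped noIso S (S' ∷ Ss) A near =
    ¬final-nearTrapped noIso S' Ss _ (step-nearTrapped noIso near)

  ∣N⟦S⟧∣≤[Δ+1]h : ∀ {h} S → ∣ S ∣ ≤ h → ∣ N⟦ S ⟧ ∣ ≤ (Δ + 1) * h
  ∣N⟦S⟧∣≤[Δ+1]h S ∣S∣≤h = ≤-trans (∣⋃∣≤ (Δ + 1) S N[_] ∣N[v]∣≤Δ+1) (*-monoʳ-≤ (Δ + 1) ∣S∣≤h)

  huntersWin⇒blindWins : NoIsolatedVertices G → ∀ {h} → HuntersWin G h → BlindWins G ((Δ + 1) * h)
  huntersWin⇒blindWins noIso ([] , [] , win) =
    ⊥ , [] , ≤-trans (≤-reflexive (∣⊥∣≡0 (n G))) z≤n , [] , λ u _ → win u tt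
  huntersWin⇒blindWins noIso (S ∷ Ss , ∣S∣≤h ∷ ∣Ss∣≤h , win) =
    N⟦ S ⟧ , map N⟦_⟧ Ss , ∣N⟦S⟧∣≤[Δ+1]h S ∣S∣≤h ,
    All.map⁺ (All.map (λ {S} → ∣N⟦S⟧∣≤[Δ+1]h S) ∣Ss∣≤h) ,
    ¬final-nearTrapped noIso S Ss _ (λ u∉C₁ → inj₁ (∉N⟦⟧⇒∉ u∉C₁ , win _))

theorem7p9 : (G : Graph) → NoIsolatedVertices G → (h b : ℕ) →
    IsHuntingNumber G h → IsBcw1 G b → b ≤ (maxDegree G + 1) * h
theorem7p9 G noIso h b (huntersWin , _) (_ , bMinimal) =
  ≮⇒≥ (λ smaller → bMinimal _ smaller (huntersWin⇒blindWins G noIso huntersWin))
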